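{- Let $p$ be a prime, $k\ge2$, and let $[a_0,\dots,a_{k-1}]$ be an algebraic $k$-gon modulo $p$, with $f(x)=a_0+a_1x+\dots+a_{k-1}x^{k-1}\in\mathbb{F}_p[x]$. Suppose $x^k-1=\prod_i g_i(x)$ with the $g_i$ irreducible over $\mathbb{F}_p$, and suppose $\gcd(f(x),x^k-1)=\prod_{j=1}^{\ell}g_{i_j}(x)$. Then the monodromy group of $[a_0,\dots,a_{k-1}]$ is $C_p^{k-d}\rtimes C_k$ where $d=\sum_{j=1}^{\ell}\deg(g_{i_j}(x))$.
   Context: For integers $k\ge2$, $n\ge1$, a $k$-tuple of nonnegative integers $[a_0,\dots,a_{k-1}]$ is an algebraic $k$-gon modulo $n$ if $a_0+\dots+a_{k-1}\equiv0\pmod n$ and $\gcd(a_0,\dots,a_{k-1},n)=1$. Its monodromy group is $N\rtimes C_k$, where $N\subseteq(\mathbb{Z}/n\mathbb{Z})^k$ is the additive subgroup generated by the columns of the circulant matrix with $(i,j)$ entry $a_{(i-j)\bmod k}$, and $C_k$ acts by cyclic permutation of coordinates. "Monodromy group $C_p^r\rtimes C_k$" means $N\cong C_p^r$. -}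

module Defs where

open import Data.Nat as ℕ using (ℕ; zero; suc; _≤ᵇ_)
open import Data.Nat.Divisibility using (_∣_; _∣?_)
open import Data.Nat.GCD using (gcd)
open import Data.Integer as ℤ using (ℤ; +_; 0ℤ; 1ℤ; -1ℤ)
open import Data.Fin as Fin using (Fin; toℕ)
open import Data.Vec using (Vec; toList)
open import Data.List using (List; []; _∷_; map; foldr; replicate; _++_; [_])
open import Data.Bool using (Bool; true; _∧_; if_then_else_)
open import Data.Product using (Σ; _×_)
open import Data.Sum using (_⊎_)
open import Relation.Nullary using (¬_)
open import Relation.Binary.PropositionalEquality using (_≡_)
open import Relation.Nullary.Decidable using (⌊_⌋)

infix 4 _≡_[mod_]
_≡_[mod_] : ℤ → ℤ → ℕ → Set
a ≡ b [mod p ] = p ∣ ℤ.∣ a ℤ.- b ∣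

sumℕ : ∀ {k} → Vec ℕ k → ℕ
sumℕ as = foldr ℕ._+_ 0 (toList as)

gcdAll : ∀ {k} → Vec ℕ k → ℕ → ℕ
gcdAll as n = foldr gcd n (toList as)

IsAlgebraicGon : (k n : ℕ) → Vec ℕ k → Set
IsAlgebraicGon k n as = (+ sumℕ as ≡ 0ℤ [mod n ]) × (gcdAll as n ≡ 1)

-- entry of a list at a natural index (0 outside the list)
nth : List ℤ → ℕ → ℤ
nth []       _       = 0ℤ
nth (a ∷ _)  zero    = a
nth (_ ∷ as) (suc i) = nth as i

idx : (k : ℕ) → Fin k → Fin k → ℕ
idx k i j = if toℕ j ≤ᵇ toℕ i then toℕ i ℕ.∸ toℕ j else (k ℕ.+ toℕ i) ℕ.∸ toℕ j

circ : ∀ {k} → Vec ℕ k → Fin k → Fin k → ℤ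
circ {k} as i j = nth (map +_ (toList as)) (idx k i j)

Σℤ : ∀ {k} → (Fin k → ℤ) → ℤ
Σℤ {zero}  f = 0ℤ
Σℤ {suc k} f = f Fin.zero ℤ.+ Σℤ (λ i → f (Fin.suc i))


-- v ∈ N ⊆ (ℤ/nℤ)^k : v is a ℤ-linear combination of the columns
-- of the circulant matrix (the additive subgroup they generate).
InN : (n : ℕ) → ∀ {k} → Vec ℕ k → (Fin k → ℤ) → Set
InN n {k} as v = Σ (Fin k → ℤ) λ c →
  ∀ i → v i ≡ Σℤ (λ j → c j ℤ.* circ as i j) [mod n ]

-- N ≅ C_p^r : an explicit group isomorphism (ℤ/pℤ)^r → N.
-- Elements of (ℤ/pℤ)^m are represented by Fin m → ℤ up to
-- componentwise congruence mod p.
_≈[_]_ : ∀ {m} → (Fin m → ℤ) → ℕ → (Fin m → ℤ) → Set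
u ≈[ p ] v = ∀ i → u i ≡ v i [mod p ]

NIsoCpPow : (p : ℕ) → ∀ {k} → Vec ℕ k → (r : ℕ) → Set
NIsoCpPow p {k} as r =
  Σ ((Fin r → ℤ) → (Fin k → ℤ)) λ φ →
      (∀ u u′ → u ≈[ p ] u′ → φ u ≈[ p ] φ u′)
    ×
      (∀ u u′ → φ (λ i → u i ℤ.+ u′ i) ≈[ p ] (λ i → φ u i ℤ.+ φ u′ i))
    ×
      (∀ u u′ → φ u ≈[ p ] φ u′ → u ≈[ p ] u′)
    ×
      (∀ u → InN p as (φ u))
    ×
      (∀ v → InN p as v → Σ (Fin r → ℤ) λ u → φ u ≈[ p ] v)

-- Polynomials over 𝔽_p, as coefficient lists over ℤ (constant term
-- first), considered up to coefficientwise congruence mod p.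

Poly : Set
Poly = List ℤ

addP : Poly → Poly → Poly
addP []       q        = q
addP (a ∷ p)  []       = a ∷ p
addP (a ∷ p)  (b ∷ q)  = (a ℤ.+ b) ∷ addP p q

mulP : Poly → Poly → Poly
mulP []      q = []
mulP (a ∷ p) q = addP (map (a ℤ.*_) q) (0ℤ ∷ mulP p q)

prodP : List Poly → Poly
prodP = foldr mulP [ 1ℤ ]

_≈P[_]_ : Poly → ℕ → Poly → Set
f ≈P[ p ] g = ∀ i → nth f i ≡ nth g i [mod p ]

_∣P[_]_ : Poly → ℕ → Poly → Set
f ∣P[ p ] g = Σ Poly λ h → mulP f h ≈P[ p ] g

isZeroP : ℕ → Poly → Bool
isZeroP p []      = true
isZeroP p (a ∷ f) = ⌊ p ∣? ℤ.∣ a ∣ ⌋ ∧ isZeroP p f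

-- degree in 𝔽_p[x] (the zero polynomial gets degree 0)
deg : ℕ → Poly → ℕ
deg p []      = 0
deg p (a ∷ f) = if isZeroP p f then 0 else suc (deg p f)

IsUnitP : ℕ → Poly → Set
IsUnitP p f = (deg p f ≡ 0) × ¬ (p ∣ ℤ.∣ nth f 0 ∣)

IrreducibleP : ℕ → Poly → Set
IrreducibleP p f = (1 ℕ.≤ deg p f)
  × (∀ g h → f ≈P[ p ] mulP g h → IsUnitP p g ⊎ IsUnitP p h)

IsGCDP : ℕ → Poly → Poly → Poly → Set
IsGCDP p f g d = (d ∣P[ p ] f) × (d ∣P[ p ] g)
  × (∀ e → e ∣P[ p ] f → e ∣P[ p ] g → e ∣P[ p ] d)

-- x^k - 1  (for k ≥ 1)
xᵏ-1 : ℕ → Poly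
xᵏ-1 k = -1ℤ ∷ (replicate (k ℕ.∸ 1) 0ℤ ++ [ 1ℤ ])

polyOf : ∀ {k} → Vec ℕ k → Poly
polyOf as = map +_ (toList as)

-- Identify a vector of (ℤ/p)^k with a polynomial of degree < k over 𝔽_p. Column j of the circulant
-- matrix of f = a₀ + a₁x + … + a_{k-1}x^{k-1} is x^j f reduced modulo x^k − 1, so N is the ideal (f)
-- of 𝔽_p[x]/(x^k − 1). Euclid's algorithm writes d = gcd(f, x^k − 1) as s f + t (x^k − 1), so this
-- ideal is (d); since d divides x^k − 1, its elements are exactly the products d·u with
-- deg u < k − deg d, which need no reduction. Multiplication by d is injective, so u ↦ d·u is an
-- isomorphism 𝔽_p^{k − deg d} ≅ N, and deg d = Σ deg g_{i_j} because degrees add in 𝔽_p[x].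

module Submission where

open import Defs
open import Data.Nat as ℕ using (ℕ; zero; suc; _≤_; _<_; _∸_; _≤ᵇ_; z≤n; s≤s)
import Data.Nat.Properties as ℕ
import Data.Nat.Divisibility as ℕ
open import Data.Nat.Coprimality using (Coprime; coprime-Bézout)
open import Data.Nat.GCD using (module Bézout)
open import Data.Nat.ListAction using (sum)
open import Data.Nat.Primality using (Prime; prime⇒irreducible; prime⇒nonTrivial; euclidsLemma)
open import Data.Integer as ℤ using (ℤ; +_; 0ℤ; 1ℤ; -1ℤ; _+_; _*_; -_; _-_)
import Data.Integer.Properties as ℤ
open import Data.Integer.Divisibility.Signed
  using ( _∣_; _∣?_; divides; ∣ᵤ⇒∣; ∣⇒∣ᵤ; ∣m∣n⇒∣m+n; ∣m⇒∣-m; ∣m∣n⇒∣m-n; ∣m+n∣m⇒∣n; ∣m+n∣n⇒∣m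
        ; ∣n⇒∣m*n; ∣m⇒∣m*n)
open import Data.Integer.Tactic.RingSolver using (solve-∀)
open import Data.Bool using (true; false; T)
open import Data.Unit using (tt)
open import Data.Fin as Fin using (Fin; toℕ; fromℕ<)
import Data.Fin.Properties as Fin
open import Data.Vec using (Vec; toList)
import Data.Vec.Properties as Vec
open import Data.List using (List; []; _∷_; [_]; _++_; replicate; drop; length; map; lookup)
import Data.List.Properties as List
open import Data.List.Relation.Unary.All as All using (All)
open import Data.List.Relation.Unary.All.Properties using (map⁺)
open import Data.List.Relation.Unary.Unique.Propositional using (Unique)
open import Data.List.Membership.Propositional.Properties using (∈-lookup)
open import Data.Product using (Σ; _×_; _,_; proj₁; proj₂)
open import Data.Sum using (_⊎_; inj₁; inj₂)
open import Function using (_∘_)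
open import Relation.Binary.Bundles using (Setoid)
open import Relation.Binary.Definitions using (tri<; tri≈; tri>)
open import Relation.Binary.PropositionalEquality
  using (_≡_; refl; sym; trans; cong; cong₂; subst; module ≡-Reasoning)
import Relation.Binary.Reasoning.Setoid as SetoidReasoning
open import Relation.Nullary using (¬_; yes; no; contradiction)

-- Polynomials over ℤ, up to coefficientwise equality

infix 4 _≐_
record _≐_ (f g : Poly) : Set where
  constructor mk≐
  field at : ∀ i → nth f i ≡ nth g i
open _≐_ public

≐-setoid : Setoid _ _
≐-setoid = record
  { Carrier = Poly
  ; _≈_ = _≐_
  ; isEquivalence = record
    { refl = mk≐ λ _ → refl
    ; sym = λ e → mk≐ λ i → sym (at e i)
    ; trans = λ e e′ → mk≐ λ i → trans (at e i) (at e′ i)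
    }
  }

open Setoid ≐-setoid public
  using () renaming (refl to ≐-refl; sym to ≐-sym; trans to ≐-trans)
module ≐-Reasoning = SetoidReasoning ≐-setoid

scaleP : ℤ → Poly → Poly
scaleP a = map (a *_)

subP : Poly → Poly → Poly
subP f g = addP f (scaleP -1ℤ g)

oneP : Poly
oneP = [ 1ℤ ]

nth-addP : ∀ f g i → nth (addP f g) i ≡ nth f i + nth g i
nth-addP []      g       i       = sym (ℤ.+-identityˡ _)
nth-addP (a ∷ f) []      i       = sym (ℤ.+-identityʳ _)
nth-addP (a ∷ f) (b ∷ g) zero    = refl
nth-addP (a ∷ f) (b ∷ g) (suc i) = nth-addP f g i

nth-scaleP : ∀ a f i → nth (scaleP a f) i ≡ a * nth f i
nth-scaleP a []      i       = sym (ℤ.*-zeroʳ a)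
nth-scaleP a (x ∷ f) zero    = refl
nth-scaleP a (x ∷ f) (suc i) = nth-scaleP a f i

nth-subP : ∀ f g i → nth (subP f g) i ≡ nth f i - nth g i
nth-subP f g i = begin
  nth (subP f g) i              ≡⟨ nth-addP f (scaleP -1ℤ g) i ⟩
  nth f i + nth (scaleP -1ℤ g) i ≡⟨ cong (_+_ (nth f i)) (nth-scaleP -1ℤ g i) ⟩
  nth f i + -1ℤ * nth g i        ≡⟨ cong (_+_ (nth f i)) (ℤ.-1*i≡-i (nth g i)) ⟩
  nth f i - nth g i              ∎
  where open ≡-Reasoning

nth-≥length : ∀ f i → length f ≤ i → nth f i ≡ 0ℤ
nth-≥length []      i       _         = refl
nth-≥length (a ∷ f) (suc i) (s≤s f≤i) = nth-≥length f i f≤i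

nth-mulP-∷ : ∀ a f g i → nth (mulP (a ∷ f) g) i ≡ a * nth g i + nth (0ℤ ∷ mulP f g) i
nth-mulP-∷ a f g i =
  trans (nth-addP (scaleP a g) (0ℤ ∷ mulP f g) i) (cong (_+ nth (0ℤ ∷ mulP f g) i) (nth-scaleP a g i))

∷-cong : ∀ {a b f g} → a ≡ b → f ≐ g → a ∷ f ≐ b ∷ g
∷-cong a≡b f≐g = mk≐ λ { zero → a≡b ; (suc i) → at f≐g i }

addP-cong : ∀ {f f′ g g′} → f ≐ f′ → g ≐ g′ → addP f g ≐ addP f′ g′
addP-cong {f} {f′} {g} {g′} f≐f′ g≐g′ = mk≐ λ i →
  trans (nth-addP f g i) (trans (cong₂ _+_ (at f≐f′ i) (at g≐g′ i)) (sym (nth-addP f′ g′ i)))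

scaleP-cong : ∀ a {f g} → f ≐ g → scaleP a f ≐ scaleP a g
scaleP-cong a {f} {g} f≐g = mk≐ λ i →
  trans (nth-scaleP a f i) (trans (cong (a *_) (at f≐g i)) (sym (nth-scaleP a g i)))

subP-cong : ∀ {f f′ g g′} → f ≐ f′ → g ≐ g′ → subP f g ≐ subP f′ g′
subP-cong f≐f′ g≐g′ = addP-cong f≐f′ (scaleP-cong -1ℤ g≐g′)

addP-identityʳ : ∀ f → addP f [] ≐ f
addP-identityʳ []      = ≐-refl
addP-identityʳ (a ∷ f) = ≐-refl

addP-comm : ∀ f g → addP f g ≐ addP g f
addP-comm f g = mk≐ λ i →
  trans (nth-addP f g i) (trans (ℤ.+-comm (nth f i) (nth g i)) (sym (nth-addP g f i)))

addP-assoc : ∀ f g h → addP (addP f g) h ≐ addP f (addP g h)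
addP-assoc f g h = mk≐ λ i → begin
  nth (addP (addP f g) h) i         ≡⟨ nth-addP (addP f g) h i ⟩
  nth (addP f g) i + nth h i        ≡⟨ cong (_+ nth h i) (nth-addP f g i) ⟩
  (nth f i + nth g i) + nth h i     ≡⟨ ℤ.+-assoc (nth f i) (nth g i) (nth h i) ⟩
  nth f i + (nth g i + nth h i)     ≡⟨ cong (_+_ (nth f i)) (nth-addP g h i) ⟨
  nth f i + nth (addP g h) i        ≡⟨ nth-addP f (addP g h) i ⟨
  nth (addP f (addP g h)) i         ∎
  where open ≡-Reasoning

addP-leftComm : ∀ f g h → addP f (addP g h) ≐ addP g (addP f h)
addP-leftComm f g h = mk≐ λ i → begin
  nth (addP f (addP g h)) i         ≡⟨ nth-addP f (addP g h) i ⟩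
  nth f i + nth (addP g h) i        ≡⟨ cong (_+_ (nth f i)) (nth-addP g h i) ⟩
  nth f i + (nth g i + nth h i)     ≡⟨ leftComm (nth f i) (nth g i) (nth h i) ⟩
  nth g i + (nth f i + nth h i)     ≡⟨ cong (_+_ (nth g i)) (nth-addP f h i) ⟨
  nth g i + nth (addP f h) i        ≡⟨ nth-addP g (addP f h) i ⟨
  nth (addP g (addP f h)) i         ∎
  where
  open ≡-Reasoning
  leftComm : ∀ x y z → x + (y + z) ≡ y + (x + z)
  leftComm = solve-∀

addP-interchange : ∀ f g h l → addP (addP f g) (addP h l) ≐ addP (addP f h) (addP g l)
addP-interchange f g h l = mk≐ λ i → begin
  nth (addP (addP f g) (addP h l)) i              ≡⟨ nth-addP (addP f g) (addP h l) i ⟩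
  nth (addP f g) i + nth (addP h l) i             ≡⟨ cong₂ _+_ (nth-addP f g i) (nth-addP h l i) ⟩
  (nth f i + nth g i) + (nth h i + nth l i)       ≡⟨ interchange (nth f i) (nth g i) (nth h i) (nth l i) ⟩
  (nth f i + nth h i) + (nth g i + nth l i)       ≡⟨ cong₂ _+_ (nth-addP f h i) (nth-addP g l i) ⟨
  nth (addP f h) i + nth (addP g l) i             ≡⟨ nth-addP (addP f h) (addP g l) i ⟨
  nth (addP (addP f h) (addP g l)) i              ∎
  where
  open ≡-Reasoning
  interchange : ∀ x y z w → (x + y) + (z + w) ≡ (x + z) + (y + w)
  interchange = solve-∀

subP-addP-cancelˡ : ∀ f g → subP (addP f g) f ≐ g
subP-addP-cancelˡ f g = mk≐ λ i → begin
  nth (subP (addP f g) f) i         ≡⟨ nth-subP (addP f g) f i ⟩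
  nth (addP f g) i - nth f i        ≡⟨ cong (_- nth f i) (nth-addP f g i) ⟩
  (nth f i + nth g i) - nth f i     ≡⟨ cancel (nth f i) (nth g i) ⟩
  nth g i                           ∎
  where
  open ≡-Reasoning
  cancel : ∀ x y → (x + y) - x ≡ y
  cancel = solve-∀

addP-subP-cancel : ∀ f g → addP g (subP f g) ≐ f
addP-subP-cancel f g = mk≐ λ i → begin
  nth (addP g (subP f g)) i         ≡⟨ nth-addP g (subP f g) i ⟩
  nth g i + nth (subP f g) i        ≡⟨ cong (_+_ (nth g i)) (nth-subP f g i) ⟩
  nth g i + (nth f i - nth g i)     ≡⟨ cancel (nth f i) (nth g i) ⟩
  nth f i                           ∎
  where
  open ≡-Reasoning
  cancel : ∀ x y → y + (x - y) ≡ x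
  cancel = solve-∀

subP-flip : ∀ f g → subP g f ≐ scaleP -1ℤ (subP f g)
subP-flip f g = mk≐ λ i → begin
  nth (subP g f) i                ≡⟨ nth-subP g f i ⟩
  nth g i - nth f i               ≡⟨ flip (nth f i) (nth g i) ⟩
  -1ℤ * (nth f i - nth g i)       ≡⟨ cong (-1ℤ *_) (nth-subP f g i) ⟨
  -1ℤ * nth (subP f g) i          ≡⟨ nth-scaleP -1ℤ (subP f g) i ⟨
  nth (scaleP -1ℤ (subP f g)) i   ∎
  where
  open ≡-Reasoning
  flip : ∀ x y → y - x ≡ -1ℤ * (x - y)
  flip = solve-∀

subP-split : ∀ f g h → subP f h ≐ addP (subP f g) (subP g h)
subP-split f g h = mk≐ λ i → begin
  nth (subP f h) i                          ≡⟨ nth-subP f h i ⟩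
  nth f i - nth h i                         ≡⟨ split (nth f i) (nth g i) (nth h i) ⟩
  (nth f i - nth g i) + (nth g i - nth h i) ≡⟨ cong₂ _+_ (nth-subP f g i) (nth-subP g h i) ⟨
  nth (subP f g) i + nth (subP g h) i       ≡⟨ nth-addP (subP f g) (subP g h) i ⟨
  nth (addP (subP f g) (subP g h)) i        ∎
  where
  open ≡-Reasoning
  split : ∀ x y z → x - z ≡ (x - y) + (y - z)
  split = solve-∀

subP-addP-cancelʳ : ∀ f g → subP (addP f g) g ≐ f
subP-addP-cancelʳ f g = ≐-trans (subP-cong (addP-comm f g) ≐-refl) (subP-addP-cancelˡ g f)

subP-subP-cancel : ∀ f g → subP f (subP f g) ≐ g
subP-subP-cancel f g = mk≐ λ i → begin
  nth (subP f (subP f g)) i          ≡⟨ nth-subP f (subP f g) i ⟩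
  nth f i - nth (subP f g) i         ≡⟨ cong (_-_ (nth f i)) (nth-subP f g i) ⟩
  nth f i - (nth f i - nth g i)      ≡⟨ cancel (nth f i) (nth g i) ⟩
  nth g i                            ∎
  where
  open ≡-Reasoning
  cancel : ∀ x y → x - (x - y) ≡ y
  cancel = solve-∀

scaleP-addP : ∀ a f g → scaleP a (addP f g) ≐ addP (scaleP a f) (scaleP a g)
scaleP-addP a f g = mk≐ λ i → begin
  nth (scaleP a (addP f g)) i                  ≡⟨ nth-scaleP a (addP f g) i ⟩
  a * nth (addP f g) i                         ≡⟨ cong (a *_) (nth-addP f g i) ⟩
  a * (nth f i + nth g i)                      ≡⟨ ℤ.*-distribˡ-+ a (nth f i) (nth g i) ⟩
  a * nth f i + a * nth g i                    ≡⟨ cong₂ _+_ (nth-scaleP a f i) (nth-scaleP a g i) ⟨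
  nth (scaleP a f) i + nth (scaleP a g) i      ≡⟨ nth-addP (scaleP a f) (scaleP a g) i ⟨
  nth (addP (scaleP a f) (scaleP a g)) i       ∎
  where open ≡-Reasoning

scaleP-scaleP : ∀ a b f → scaleP a (scaleP b f) ≐ scaleP (a * b) f
scaleP-scaleP a b f = mk≐ λ i → begin
  nth (scaleP a (scaleP b f)) i   ≡⟨ nth-scaleP a (scaleP b f) i ⟩
  a * nth (scaleP b f) i          ≡⟨ cong (a *_) (nth-scaleP b f i) ⟩
  a * (b * nth f i)               ≡⟨ ℤ.*-assoc a b (nth f i) ⟨
  a * b * nth f i                 ≡⟨ nth-scaleP (a * b) f i ⟨
  nth (scaleP (a * b) f) i        ∎
  where open ≡-Reasoning

mulP-zeroʳ : ∀ f → mulP f [] ≐ []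
mulP-zeroʳ []      = ≐-refl
mulP-zeroʳ (a ∷ f) = mk≐ λ { zero → refl ; (suc i) → at (mulP-zeroʳ f) i }

mulP-congʳ : ∀ f {g g′} → g ≐ g′ → mulP f g ≐ mulP f g′
mulP-congʳ []      g≐g′ = ≐-refl
mulP-congʳ (a ∷ f) g≐g′ = addP-cong (scaleP-cong a g≐g′) (∷-cong refl (mulP-congʳ f g≐g′))

mulP-distribˡ : ∀ f g h → mulP f (addP g h) ≐ addP (mulP f g) (mulP f h)
mulP-distribˡ []      g h = ≐-refl
mulP-distribˡ (a ∷ f) g h =
  ≐-trans (addP-cong (scaleP-addP a g h) (∷-cong refl (mulP-distribˡ f g h)))
          (addP-interchange (scaleP a g) (scaleP a h) (0ℤ ∷ mulP f g) (0ℤ ∷ mulP f h))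

mulP-∷ʳ : ∀ f a g → mulP f (a ∷ g) ≐ addP (scaleP a f) (0ℤ ∷ mulP f g)
mulP-∷ʳ []      a g = mk≐ λ { zero → refl ; (suc i) → refl }
mulP-∷ʳ (b ∷ f) a g =
  ∷-cong (cong (_+ 0ℤ) (ℤ.*-comm b a))
    (≐-trans (addP-cong ≐-refl (mulP-∷ʳ f a g))
             (addP-leftComm (scaleP b g) (scaleP a f) (0ℤ ∷ mulP f g)))

mulP-comm : ∀ f g → mulP f g ≐ mulP g f
mulP-comm []      g = ≐-sym (mulP-zeroʳ g)
mulP-comm (a ∷ f) g = ≐-trans (addP-cong ≐-refl (∷-cong refl (mulP-comm f g))) (≐-sym (mulP-∷ʳ g a f))

mulP-congˡ : ∀ {f f′} g → f ≐ f′ → mulP f g ≐ mulP f′ g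
mulP-congˡ {f} {f′} g f≐f′ = ≐-trans (mulP-comm f g) (≐-trans (mulP-congʳ g f≐f′) (mulP-comm g f′))

mulP-distribʳ : ∀ f g h → mulP (addP f g) h ≐ addP (mulP f h) (mulP g h)
mulP-distribʳ f g h = begin
  mulP (addP f g) h             ≈⟨ mulP-comm (addP f g) h ⟩
  mulP h (addP f g)             ≈⟨ mulP-distribˡ h f g ⟩
  addP (mulP h f) (mulP h g)    ≈⟨ addP-cong (mulP-comm h f) (mulP-comm h g) ⟩
  addP (mulP f h) (mulP g h)    ∎
  where open ≐-Reasoning

scaleP-mulP : ∀ a f g → mulP (scaleP a f) g ≐ scaleP a (mulP f g)
scaleP-mulP a []      g = ≐-refl
scaleP-mulP a (b ∷ f) g =
  ≐-trans (addP-cong (≐-sym (scaleP-scaleP a b g)) (∷-cong (sym (ℤ.*-zeroʳ a)) (scaleP-mulP a f g)))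
          (≐-sym (scaleP-addP a (scaleP b g) (0ℤ ∷ mulP f g)))

mulP-scaleP : ∀ a f g → mulP f (scaleP a g) ≐ scaleP a (mulP f g)
mulP-scaleP a f g =
  ≐-trans (mulP-comm f (scaleP a g)) (≐-trans (scaleP-mulP a g f) (scaleP-cong a (mulP-comm g f)))

mulP-subP : ∀ f g h → mulP f (subP g h) ≐ subP (mulP f g) (mulP f h)
mulP-subP f g h = ≐-trans (mulP-distribˡ f g (scaleP -1ℤ h)) (addP-cong ≐-refl (mulP-scaleP -1ℤ f h))

mulP-subPʳ : ∀ f g h → mulP (subP f g) h ≐ subP (mulP f h) (mulP g h)
mulP-subPʳ f g h = ≐-trans (mulP-distribʳ f (scaleP -1ℤ g) h) (addP-cong ≐-refl (scaleP-mulP -1ℤ g h))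

mulP-x : ∀ f g → mulP (0ℤ ∷ f) g ≐ 0ℤ ∷ mulP f g
mulP-x f g = mk≐ λ i → begin
  nth (mulP (0ℤ ∷ f) g) i                  ≡⟨ nth-mulP-∷ 0ℤ f g i ⟩
  0ℤ * nth g i + nth (0ℤ ∷ mulP f g) i     ≡⟨ cong (_+ nth (0ℤ ∷ mulP f g) i) (ℤ.*-zeroˡ (nth g i)) ⟩
  0ℤ + nth (0ℤ ∷ mulP f g) i               ≡⟨ ℤ.+-identityˡ _ ⟩
  nth (0ℤ ∷ mulP f g) i                    ∎
  where open ≡-Reasoning

mulP-assoc : ∀ f g h → mulP (mulP f g) h ≐ mulP f (mulP g h)
mulP-assoc []      g h = ≐-refl
mulP-assoc (a ∷ f) g h = begin
  mulP (addP (scaleP a g) (0ℤ ∷ mulP f g)) h               ≈⟨ mulP-distribʳ (scaleP a g) (0ℤ ∷ mulP f g) h ⟩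
  addP (mulP (scaleP a g) h) (mulP (0ℤ ∷ mulP f g) h)      ≈⟨ addP-cong (scaleP-mulP a g h) (mulP-x (mulP f g) h) ⟩
  addP (scaleP a (mulP g h)) (0ℤ ∷ mulP (mulP f g) h)      ≈⟨ addP-cong ≐-refl (∷-cong refl (mulP-assoc f g h)) ⟩
  addP (scaleP a (mulP g h)) (0ℤ ∷ mulP f (mulP g h))      ∎
  where open ≐-Reasoning

mulP-identityˡ : ∀ f → mulP oneP f ≐ f
mulP-identityˡ f = mk≐ λ i → begin
  nth (mulP oneP f) i                   ≡⟨ nth-mulP-∷ 1ℤ [] f i ⟩
  1ℤ * nth f i + nth (0ℤ ∷ []) i        ≡⟨ cong₂ _+_ (ℤ.*-identityˡ (nth f i)) (nth-0∷[] i) ⟩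
  nth f i + 0ℤ                          ≡⟨ ℤ.+-identityʳ (nth f i) ⟩
  nth f i                               ∎
  where
  open ≡-Reasoning
  nth-0∷[] : ∀ i → nth (0ℤ ∷ []) i ≡ 0ℤ
  nth-0∷[] zero    = refl
  nth-0∷[] (suc i) = refl

mulP-identityʳ : ∀ f → mulP f oneP ≐ f
mulP-identityʳ f = ≐-trans (mulP-comm f oneP) (mulP-identityˡ f)

mulP-leftComm : ∀ f g h → mulP f (mulP g h) ≐ mulP g (mulP f h)
mulP-leftComm f g h = begin
  mulP f (mulP g h)   ≈⟨ mulP-assoc f g h ⟨
  mulP (mulP f g) h   ≈⟨ mulP-congˡ h (mulP-comm f g) ⟩
  mulP (mulP g f) h   ≈⟨ mulP-assoc g f h ⟩
  mulP g (mulP f h)   ∎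
  where open ≐-Reasoning

-- Coefficient vectors and linear combinations

toP : ∀ {r} → (Fin r → ℤ) → Poly
toP {zero}  u = []
toP {suc r} u = u Fin.zero ∷ toP (u ∘ Fin.suc)

nth-toP : ∀ {r} (u : Fin r → ℤ) i → nth (toP u) (toℕ i) ≡ u i
nth-toP u Fin.zero    = refl
nth-toP u (Fin.suc i) = nth-toP (u ∘ Fin.suc) i

nth-toP< : ∀ {r} (u : Fin r → ℤ) {m} (m<r : m < r) → nth (toP u) m ≡ u (fromℕ< m<r)
nth-toP< u m<r = trans (cong (nth (toP u)) (sym (Fin.toℕ-fromℕ< m<r))) (nth-toP u (fromℕ< m<r))

nth-toP≥ : ∀ {r} (u : Fin r → ℤ) m → r ≤ m → nth (toP u) m ≡ 0ℤ
nth-toP≥ {zero}  u m       _         = refl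
nth-toP≥ {suc r} u (suc m) (s≤s r≤m) = nth-toP≥ (u ∘ Fin.suc) m r≤m

toP-addP : ∀ {r} (u v : Fin r → ℤ) → toP (λ i → u i + v i) ≐ addP (toP u) (toP v)
toP-addP {zero}  u v = ≐-refl
toP-addP {suc r} u v = ∷-cong refl (toP-addP (u ∘ Fin.suc) (v ∘ Fin.suc))

Σℤ-cong : ∀ {r} {f g : Fin r → ℤ} → (∀ j → f j ≡ g j) → Σℤ f ≡ Σℤ g
Σℤ-cong {zero}  f≡g = refl
Σℤ-cong {suc r} f≡g = cong₂ _+_ (f≡g Fin.zero) (Σℤ-cong (f≡g ∘ Fin.suc))

Σℤ-zero : ∀ {r} (f : Fin r → ℤ) → (∀ j → f j ≡ 0ℤ) → Σℤ f ≡ 0ℤ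
Σℤ-zero {zero}  f f≡0 = refl
Σℤ-zero {suc r} f f≡0 = cong₂ _+_ (f≡0 Fin.zero) (Σℤ-zero (f ∘ Fin.suc) (f≡0 ∘ Fin.suc))

Σℤ-*-sub : ∀ {r} (c x y : Fin r → ℤ) →
           Σℤ (λ j → c j * (x j - y j)) ≡ Σℤ (λ j → c j * x j) - Σℤ (λ j → c j * y j)
Σℤ-*-sub {zero}  c x y = refl
Σℤ-*-sub {suc r} c x y = begin
  c₀ * (x₀ - y₀) + Σℤ (λ j → c′ j * (x′ j - y′ j))               ≡⟨ cong (_+_ (c₀ * (x₀ - y₀))) (Σℤ-*-sub c′ x′ y′) ⟩
  c₀ * (x₀ - y₀) + (Σℤ (λ j → c′ j * x′ j) - Σℤ (λ j → c′ j * y′ j)) ≡⟨ regroup c₀ x₀ y₀ _ _ ⟩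
  (c₀ * x₀ + Σℤ (λ j → c′ j * x′ j)) - (c₀ * y₀ + Σℤ (λ j → c′ j * y′ j)) ∎
  where
  open ≡-Reasoning
  c₀ = c Fin.zero
  x₀ = x Fin.zero
  y₀ = y Fin.zero
  c′ = c ∘ Fin.suc
  x′ = x ∘ Fin.suc
  y′ = y ∘ Fin.suc
  regroup : ∀ c x y X Y → c * (x - y) + (X - Y) ≡ (c * x + X) - (c * y + Y)
  regroup = solve-∀

linComb : ∀ {r} → (Fin r → ℤ) → (Fin r → Poly) → Poly
linComb {zero}  c P = []
linComb {suc r} c P = addP (scaleP (c Fin.zero) (P Fin.zero)) (linComb (c ∘ Fin.suc) (P ∘ Fin.suc))

nth-linComb : ∀ {r} (c : Fin r → ℤ) P m → nth (linComb c P) m ≡ Σℤ (λ j → c j * nth (P j) m)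
nth-linComb {zero}  c P m = refl
nth-linComb {suc r} c P m = begin
  nth (linComb c P) m                                     ≡⟨ nth-addP (scaleP c₀ (P Fin.zero)) (linComb c′ P′) m ⟩
  nth (scaleP c₀ (P Fin.zero)) m + nth (linComb c′ P′) m  ≡⟨ cong₂ _+_ (nth-scaleP c₀ (P Fin.zero) m) (nth-linComb c′ P′ m) ⟩
  c₀ * nth (P Fin.zero) m + Σℤ (λ j → c′ j * nth (P′ j) m) ∎
  where
  open ≡-Reasoning
  c₀ = c Fin.zero
  c′ = c ∘ Fin.suc
  P′ = P ∘ Fin.suc

linComb-subP : ∀ {r} (c : Fin r → ℤ) P Q →
               linComb c (λ j → subP (P j) (Q j)) ≐ subP (linComb c P) (linComb c Q)
linComb-subP c P Q = mk≐ λ m → begin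
  nth (linComb c (λ j → subP (P j) (Q j))) m                     ≡⟨ nth-linComb c (λ j → subP (P j) (Q j)) m ⟩
  Σℤ (λ j → c j * nth (subP (P j) (Q j)) m)                      ≡⟨ Σℤ-cong (λ j → cong (c j *_) (nth-subP (P j) (Q j) m)) ⟩
  Σℤ (λ j → c j * (nth (P j) m - nth (Q j) m))                   ≡⟨ Σℤ-*-sub c (λ j → nth (P j) m) (λ j → nth (Q j) m) ⟩
  Σℤ (λ j → c j * nth (P j) m) - Σℤ (λ j → c j * nth (Q j) m)    ≡⟨ cong₂ _-_ (nth-linComb c P m) (nth-linComb c Q m) ⟨
  nth (linComb c P) m - nth (linComb c Q) m                      ≡⟨ nth-subP (linComb c P) (linComb c Q) m ⟨
  nth (subP (linComb c P) (linComb c Q)) m                       ∎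
  where open ≡-Reasoning

x·linComb : ∀ {r} (c : Fin r → ℤ) P → 0ℤ ∷ linComb c P ≐ linComb c (λ j → 0ℤ ∷ P j)
x·linComb c P = mk≐ λ where
  zero    → sym (trans (nth-linComb c (λ j → 0ℤ ∷ P j) 0) (Σℤ-zero _ λ j → ℤ.*-zeroʳ (c j)))
  (suc m) → trans (nth-linComb c P m) (sym (nth-linComb c (λ j → 0ℤ ∷ P j) (suc m)))

mulP-linComb : ∀ f {r} (c : Fin r → ℤ) P → mulP f (linComb c P) ≐ linComb c (λ j → mulP f (P j))
mulP-linComb f {zero}  c P = mulP-zeroʳ f
mulP-linComb f {suc r} c P =
  ≐-trans (mulP-distribˡ f (scaleP (c Fin.zero) (P Fin.zero)) (linComb (c ∘ Fin.suc) (P ∘ Fin.suc)))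
          (addP-cong (mulP-scaleP (c Fin.zero) f (P Fin.zero)) (mulP-linComb f (c ∘ Fin.suc) (P ∘ Fin.suc)))

shiftP : ℕ → Poly → Poly
shiftP n f = replicate n 0ℤ ++ f

nth-shiftP< : ∀ n f {m} → m < n → nth (shiftP n f) m ≡ 0ℤ
nth-shiftP< (suc n) f {zero}  _         = refl
nth-shiftP< (suc n) f {suc m} (s≤s m<n) = nth-shiftP< n f m<n

nth-shiftP≥ : ∀ n f {m} → n ≤ m → nth (shiftP n f) m ≡ nth f (m ∸ n)
nth-shiftP≥ zero    f _                 = refl
nth-shiftP≥ (suc n) f {suc m} (s≤s n≤m) = nth-shiftP≥ n f n≤m

shiftP-cong : ∀ n {f g} → f ≐ g → shiftP n f ≐ shiftP n g
shiftP-cong zero    f≐g = f≐g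
shiftP-cong (suc n) f≐g = ∷-cong refl (shiftP-cong n f≐g)

mulP-shiftP : ∀ n f g → mulP (shiftP n f) g ≐ shiftP n (mulP f g)
mulP-shiftP zero    f g = ≐-refl
mulP-shiftP (suc n) f g = ≐-trans (mulP-x (shiftP n f) g) (∷-cong refl (mulP-shiftP n f g))

mulP-toP : ∀ {r} (c : Fin r → ℤ) f → mulP (toP c) f ≐ linComb c (λ j → shiftP (toℕ j) f)
mulP-toP {zero}  c f = ≐-refl
mulP-toP {suc r} c f = addP-cong ≐-refl (≐-trans
  (∷-cong refl (mulP-toP (c ∘ Fin.suc) f))
  (x·linComb (c ∘ Fin.suc) (λ j → shiftP (toℕ j) f)))

mulP-xᵏ-1 : ∀ k → 1 ≤ k → ∀ g → mulP (xᵏ-1 k) g ≐ subP (shiftP k g) g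
mulP-xᵏ-1 (suc k) _ g = begin
  addP (scaleP -1ℤ g) (0ℤ ∷ mulP (shiftP k oneP) g)   ≈⟨ addP-cong ≐-refl (∷-cong refl xᵏ·g) ⟩
  addP (scaleP -1ℤ g) (shiftP (suc k) g)              ≈⟨ addP-comm (scaleP -1ℤ g) (shiftP (suc k) g) ⟩
  subP (shiftP (suc k) g) g                           ∎
  where
  open ≐-Reasoning
  xᵏ·g : mulP (shiftP k oneP) g ≐ shiftP k g
  xᵏ·g = ≐-trans (mulP-shiftP k oneP g) (shiftP-cong k (mulP-identityˡ g))

toP-mulColumns : ∀ {k r} (M : Fin k → Fin r → ℤ) (P : Fin r → Poly) →
             (∀ i j → M i j ≡ nth (P j) (toℕ i)) → (∀ j m → k ≤ m → nth (P j) m ≡ 0ℤ) →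
             ∀ c → toP (λ i → Σℤ (λ j → c j * M i j)) ≐ linComb c P
toP-mulColumns {k} M P M≡P P≥k c = mk≐ λ m → trans (coeff m) (sym (nth-linComb c P m))
  where
  coeff : ∀ m → nth (toP (λ i → Σℤ (λ j → c j * M i j))) m ≡ Σℤ (λ j → c j * nth (P j) m)
  coeff m with ℕ.<-≤-connex m k
  ... | inj₁ m<k = trans (nth-toP< _ m<k)
                     (Σℤ-cong λ j → cong (c j *_) (trans (M≡P _ j) (cong (nth (P j)) (Fin.toℕ-fromℕ< m<k))))
  ... | inj₂ k≤m = trans (nth-toP≥ _ m k≤m)
                     (sym (Σℤ-zero _ λ j → trans (cong (c j *_) (P≥k j m k≤m)) (ℤ.*-zeroʳ (c j))))

-- The circulant matrix

idx-≤ : ∀ k (i j : Fin k) → toℕ j ≤ toℕ i → idx k i j ≡ toℕ i ∸ toℕ j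
idx-≤ k i j j≤i with toℕ j ≤ᵇ toℕ i in eq
... | true  = refl
... | false = contradiction (subst T eq (ℕ.≤⇒≤ᵇ j≤i)) λ ()

idx-> : ∀ k (i j : Fin k) → toℕ i < toℕ j → idx k i j ≡ (k ℕ.+ toℕ i) ∸ toℕ j
idx-> k i j i<j with toℕ j ≤ᵇ toℕ i in eq
... | true  = contradiction (ℕ.≤ᵇ⇒≤ (toℕ j) (toℕ i) (subst T (sym eq) tt)) (ℕ.<⇒≱ i<j)
... | false = refl

module Circulant {k : ℕ} (as : Vec ℕ k) where

  F : Poly
  F = polyOf as

  nth-F≥ : ∀ m → k ≤ m → nth F m ≡ 0ℤ
  nth-F≥ m k≤m = nth-≥length F m (subst (_≤ m) (sym length-F) k≤m)
    where
    length-F : length F ≡ k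
    length-F = trans (List.length-map +_ (toList as)) (Vec.length-toList as)

  -- x^j F = x^k (overflow j) + (terms of degree < k)
  overflow : Fin k → Poly
  overflow j = drop (k ∸ toℕ j) F

  column : Fin k → Poly
  column j = subP (shiftP (toℕ j) F) (mulP (xᵏ-1 k) (overflow j))

  nth-overflow : ∀ j m → nth (overflow j) m ≡ nth F (k ∸ toℕ j ℕ.+ m)
  nth-overflow j m = nth-drop (k ∸ toℕ j) F m
    where
    nth-drop : ∀ n f m → nth (drop n f) m ≡ nth f (n ℕ.+ m)
    nth-drop zero    f       m = refl
    nth-drop (suc n) []      m = refl
    nth-drop (suc n) (a ∷ f) m = nth-drop n f m

  nth-overflow≥ : ∀ j m → toℕ j ≤ m → nth (overflow j) m ≡ 0ℤ
  nth-overflow≥ j m j≤m = trans (nth-overflow j m) (nth-F≥ _ (begin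
    k                       ≡⟨ ℕ.m∸n+n≡m (ℕ.<⇒≤ (Fin.toℕ<n j)) ⟨
    k ∸ toℕ j ℕ.+ toℕ j     ≤⟨ ℕ.+-monoʳ-≤ (k ∸ toℕ j) j≤m ⟩
    k ∸ toℕ j ℕ.+ m         ∎))
    where open ℕ.≤-Reasoning

  nth-column : 1 ≤ k → ∀ j m {x y z} →
    nth (shiftP (toℕ j) F) m ≡ x → nth (shiftP k (overflow j)) m ≡ y → nth (overflow j) m ≡ z →
    nth (column j) m ≡ x - (y - z)
  nth-column 1≤k j m refl refl refl = trans (nth-subP (shiftP (toℕ j) F) (mulP (xᵏ-1 k) (overflow j)) m)
    (cong (_-_ (nth (shiftP (toℕ j) F) m))
      (trans (at (mulP-xᵏ-1 k 1≤k (overflow j)) m) (nth-subP (shiftP k (overflow j)) (overflow j) m)))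

  circ≡column : 1 ≤ k → ∀ i j → circ as i j ≡ nth (column j) (toℕ i)
  circ≡column 1≤k i j with ℕ.≤-<-connex (toℕ j) (toℕ i)
  ... | inj₁ j≤i = begin
    nth F (idx k i j)                   ≡⟨ cong (nth F) (idx-≤ k i j j≤i) ⟩
    nth F (toℕ i ∸ toℕ j)               ≡⟨ x-[0-0]≡x (nth F (toℕ i ∸ toℕ j)) ⟨
    nth F (toℕ i ∸ toℕ j) - (0ℤ - 0ℤ)   ≡⟨ nth-column 1≤k j (toℕ i) (nth-shiftP≥ (toℕ j) F j≤i)
                                             (nth-shiftP< k _ (Fin.toℕ<n i)) (nth-overflow≥ j (toℕ i) j≤i) ⟨
    nth (column j) (toℕ i)              ∎
    where
    open ≡-Reasoning
    x-[0-0]≡x : ∀ x → x - (0ℤ - 0ℤ) ≡ x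
    x-[0-0]≡x = solve-∀
  ... | inj₂ i<j = begin
    nth F (idx k i j)                   ≡⟨ cong (nth F) (trans (idx-> k i j i<j) (ℕ.+-∸-comm (toℕ i) (ℕ.<⇒≤ (Fin.toℕ<n j)))) ⟩
    nth F (k ∸ toℕ j ℕ.+ toℕ i)         ≡⟨ 0-[0-y]≡y (nth F (k ∸ toℕ j ℕ.+ toℕ i)) ⟨
    0ℤ - (0ℤ - nth F (k ∸ toℕ j ℕ.+ toℕ i))
                                        ≡⟨ nth-column 1≤k j (toℕ i) (nth-shiftP< (toℕ j) F i<j)
                                             (nth-shiftP< k _ (Fin.toℕ<n i)) (nth-overflow j (toℕ i)) ⟨
    nth (column j) (toℕ i)              ∎
    where
    open ≡-Reasoning
    0-[0-y]≡y : ∀ y → 0ℤ - (0ℤ - y) ≡ y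
    0-[0-y]≡y = solve-∀

  nth-column≥ : 1 ≤ k → ∀ j m → k ≤ m → nth (column j) m ≡ 0ℤ
  nth-column≥ 1≤k j m k≤m =
    trans (nth-column 1≤k j m (nth-shiftP≥ (toℕ j) F j≤m) shifted-overflow (nth-overflow≥ j m j≤m))
          (x-[x-0]≡0 (nth F (m ∸ toℕ j)))
    where
    j≤k : toℕ j ≤ k
    j≤k = ℕ.<⇒≤ (Fin.toℕ<n j)
    j≤m : toℕ j ≤ m
    j≤m = ℕ.≤-trans j≤k k≤m
    shifted-overflow : nth (shiftP k (overflow j)) m ≡ nth F (m ∸ toℕ j)
    shifted-overflow = trans (nth-shiftP≥ k (overflow j) k≤m) (trans (nth-overflow j (m ∸ k)) (cong (nth F)
      (trans (sym (ℕ.+-∸-comm (m ∸ k) j≤k)) (cong (_∸ toℕ j) (ℕ.m+[n∸m]≡n k≤m)))))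
    x-[x-0]≡0 : ∀ x → x - (x - 0ℤ) ≡ 0ℤ
    x-[x-0]≡0 = solve-∀

  circulant : 1 ≤ k → ∀ c →
    toP (λ i → Σℤ (λ j → c j * circ as i j)) ≐ subP (mulP (toP c) F) (mulP (xᵏ-1 k) (linComb c overflow))
  circulant 1≤k c = begin
    toP (λ i → Σℤ (λ j → c j * circ as i j))
      ≈⟨ toP-mulColumns (circ as) column (circ≡column 1≤k) (nth-column≥ 1≤k) c ⟩
    linComb c column
      ≈⟨ linComb-subP c (λ j → shiftP (toℕ j) F) (λ j → mulP (xᵏ-1 k) (overflow j)) ⟩
    subP (linComb c (λ j → shiftP (toℕ j) F)) (linComb c (λ j → mulP (xᵏ-1 k) (overflow j)))
      ≈⟨ subP-cong (≐-sym (mulP-toP c F)) (≐-sym (mulP-linComb (xᵏ-1 k) c overflow)) ⟩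
    subP (mulP (toP c) F) (mulP (xᵏ-1 k) (linComb c overflow)) ∎
    where open ≐-Reasoning

-- Reduction modulo p

module Congruence (p : ℕ) where

  IsZero : Poly → Set
  IsZero f = ∀ i → + p ∣ nth f i

  DegreeBelow : ℕ → Poly → Set
  DegreeBelow n f = ∀ i → n ≤ i → + p ∣ nth f i

  -- the relation _≈P[ p ]_, phrased with signed divisibility so that ℤ-algebra applies directly
  infix 4 _≈_
  record _≈_ (f g : Poly) : Set where
    constructor mk≈
    field atz : ∀ i → + p ∣ nth f i - nth g i
  open _≈_ public

  p∣0 : + p ∣ 0ℤ
  p∣0 = divides 0ℤ refl

  p∣-cancel : ∀ a → + p ∣ a - a
  p∣-cancel a = subst (+ p ∣_) (sym (ℤ.+-inverseʳ a)) p∣0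

  p∣-transfer : ∀ {a b} → + p ∣ a - b → + p ∣ a → + p ∣ b
  p∣-transfer {a} {b} p∣a-b p∣a = subst (+ p ∣_) (a-[a-b]≡b a b) (∣m∣n⇒∣m-n p∣a p∣a-b)
    where
    a-[a-b]≡b : ∀ a b → a - (a - b) ≡ b
    a-[a-b]≡b = solve-∀

  ≈-setoid : Setoid _ _
  ≈-setoid = record
    { Carrier = Poly
    ; _≈_ = _≈_
    ; isEquivalence = record
      { refl = λ {f} → mk≈ λ i → p∣-cancel (nth f i)
      ; sym = λ {f} {g} f≈g → mk≈ λ i →
          subst (+ p ∣_) (flip (nth f i) (nth g i)) (∣m⇒∣-m (atz f≈g i))
      ; trans = λ {f} {g} {h} f≈g g≈h → mk≈ λ i →
          subst (+ p ∣_) (chain (nth f i) (nth g i) (nth h i)) (∣m∣n⇒∣m+n (atz f≈g i) (atz g≈h i))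
      }
    }
    where
    flip : ∀ a b → - (a - b) ≡ b - a
    flip = solve-∀
    chain : ∀ a b c → (a - b) + (b - c) ≡ a - c
    chain = solve-∀

  open Setoid ≈-setoid public using () renaming (refl to ≈-refl; sym to ≈-sym; trans to ≈-trans)
  module ≈-Reasoning = SetoidReasoning ≈-setoid

  ≐⇒≈ : ∀ {f g} → f ≐ g → f ≈ g
  ≐⇒≈ {f} f≐g = mk≈ λ i → subst (λ x → + p ∣ nth f i - x) (at f≐g i) (p∣-cancel (nth f i))

  ≈P⇒≈ : ∀ {f g} → f ≈P[ p ] g → f ≈ g
  ≈P⇒≈ f≈g = mk≈ λ i → ∣ᵤ⇒∣ (f≈g i)

  ≈⇒≈P : ∀ {f g} → f ≈ g → f ≈P[ p ] g
  ≈⇒≈P f≈g i = ∣⇒∣ᵤ (atz f≈g i)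

  IsZero⇒≈[] : ∀ {f} → IsZero f → f ≈ []
  IsZero⇒≈[] {f} f≈0 = mk≈ λ i → subst (+ p ∣_) (sym (ℤ.+-identityʳ (nth f i))) (f≈0 i)

  ≈[]⇒IsZero : ∀ {f} → f ≈ [] → IsZero f
  ≈[]⇒IsZero {f} f≈[] i = subst (+ p ∣_) (ℤ.+-identityʳ (nth f i)) (atz f≈[] i)

  ≈⇒IsZero-subP : ∀ {f g} → f ≈ g → IsZero (subP f g)
  ≈⇒IsZero-subP {f} {g} f≈g i = subst (+ p ∣_) (sym (nth-subP f g i)) (atz f≈g i)

  IsZero-subP⇒≈ : ∀ {f g} → IsZero (subP f g) → f ≈ g
  IsZero-subP⇒≈ {f} {g} f-g≈0 = mk≈ λ i → subst (+ p ∣_) (nth-subP f g i) (f-g≈0 i)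

  ∷-cong≈ : ∀ a {f g} → f ≈ g → a ∷ f ≈ a ∷ g
  ∷-cong≈ a f≈g = mk≈ λ { zero → p∣-cancel a ; (suc i) → atz f≈g i }

  DegreeBelow-mono : ∀ {m n f} → m ≤ n → DegreeBelow m f → DegreeBelow n f
  DegreeBelow-mono m≤n f<m i n≤i = f<m i (ℕ.≤-trans m≤n n≤i)

  DegreeBelow-≈ : ∀ {n f g} → f ≈ g → DegreeBelow n f → DegreeBelow n g
  DegreeBelow-≈ f≈g f<n i n≤i = p∣-transfer (atz f≈g i) (f<n i n≤i)

  DegreeBelow-subP : ∀ {n f g} → DegreeBelow n f → DegreeBelow n g → DegreeBelow n (subP f g)
  DegreeBelow-subP {f = f} {g} f<n g<n i n≤i =
    subst (+ p ∣_) (sym (nth-subP f g i)) (∣m∣n⇒∣m-n (f<n i n≤i) (g<n i n≤i))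

  IsZero-mulPˡ : ∀ f g → IsZero f → IsZero (mulP f g)
  IsZero-mulPˡ []      g f≈0 i = p∣0
  IsZero-mulPˡ (a ∷ f) g f≈0 i =
    subst (+ p ∣_) (sym (nth-mulP-∷ a f g i)) (∣m∣n⇒∣m+n (∣m⇒∣m*n (nth g i) (f≈0 0)) (tail i))
    where
    tail : ∀ i → + p ∣ nth (0ℤ ∷ mulP f g) i
    tail zero    = p∣0
    tail (suc i) = IsZero-mulPˡ f g (λ j → f≈0 (suc j)) i

  IsZero-mulPʳ : ∀ f g → IsZero g → IsZero (mulP f g)
  IsZero-mulPʳ f g g≈0 i = subst (+ p ∣_) (at (mulP-comm g f) i) (IsZero-mulPˡ g f g≈0 i)

  addP-cong≈ : ∀ {f f′ g g′} → f ≈ f′ → g ≈ g′ → addP f g ≈ addP f′ g′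
  addP-cong≈ {f} {f′} {g} {g′} f≈f′ g≈g′ = mk≈ λ i →
    subst (+ p ∣_) (sym (trans (cong₂ _-_ (nth-addP f g i) (nth-addP f′ g′ i)) (regroup (nth f i) (nth g i) (nth f′ i) (nth g′ i))))
      (∣m∣n⇒∣m+n (atz f≈f′ i) (atz g≈g′ i))
    where
    regroup : ∀ a b c d → (a + b) - (c + d) ≡ (a - c) + (b - d)
    regroup = solve-∀

  scaleP-cong≈ : ∀ a {f g} → f ≈ g → scaleP a f ≈ scaleP a g
  scaleP-cong≈ a {f} {g} f≈g = mk≈ λ i →
    subst (+ p ∣_) (sym (trans (cong₂ _-_ (nth-scaleP a f i) (nth-scaleP a g i)) (factor a (nth f i) (nth g i))))
      (∣n⇒∣m*n a (atz f≈g i))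
    where
    factor : ∀ a b c → a * b - a * c ≡ a * (b - c)
    factor = solve-∀

  subP-cong≈ : ∀ {f f′ g g′} → f ≈ f′ → g ≈ g′ → subP f g ≈ subP f′ g′
  subP-cong≈ f≈f′ g≈g′ = addP-cong≈ f≈f′ (scaleP-cong≈ -1ℤ g≈g′)

  mulP-cong≈ˡ : ∀ {f f′} g → f ≈ f′ → mulP f g ≈ mulP f′ g
  mulP-cong≈ˡ {f} {f′} g f≈f′ = IsZero-subP⇒≈ λ i →
    subst (+ p ∣_) (at (mulP-subPʳ f f′ g) i) (IsZero-mulPˡ (subP f f′) g (≈⇒IsZero-subP f≈f′) i)

  mulP-cong≈ʳ : ∀ f {g g′} → g ≈ g′ → mulP f g ≈ mulP f g′
  mulP-cong≈ʳ f {g} {g′} g≈g′ =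
    ≈-trans (≐⇒≈ (mulP-comm f g)) (≈-trans (mulP-cong≈ˡ f g≈g′) (≐⇒≈ (mulP-comm g′ f)))

  infix 4 _∣ₚ_
  record _∣ₚ_ (g f : Poly) : Set where
    constructor mk∣ₚ
    field
      cofactor : Poly
      g·h≈f    : mulP g cofactor ≈ f

  ∣P⇒∣ₚ : ∀ {g f} → g ∣P[ p ] f → g ∣ₚ f
  ∣P⇒∣ₚ (h , gh≈f) = mk∣ₚ h (≈P⇒≈ gh≈f)

  ∣ₚ⇒∣P : ∀ {g f} → g ∣ₚ f → g ∣P[ p ] f
  ∣ₚ⇒∣P (mk∣ₚ h gh≈f) = h , ≈⇒≈P gh≈f

  ∣ₚ-refl : ∀ f → f ∣ₚ f
  ∣ₚ-refl f = mk∣ₚ oneP (≐⇒≈ (mulP-identityʳ f))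

  ∣ₚ-zero : ∀ g {f} → IsZero f → g ∣ₚ f
  ∣ₚ-zero g f≈0 = mk∣ₚ [] (≈-trans (≐⇒≈ (mulP-zeroʳ g)) (≈-sym (IsZero⇒≈[] f≈0)))

  ∣ₚ-resp-≈ : ∀ {g f f′} → g ∣ₚ f → f ≈ f′ → g ∣ₚ f′
  ∣ₚ-resp-≈ (mk∣ₚ h gh≈f) f≈f′ = mk∣ₚ h (≈-trans gh≈f f≈f′)

  ∣ₚ-mulPʳ : ∀ {g f} → g ∣ₚ f → ∀ q → g ∣ₚ mulP f q
  ∣ₚ-mulPʳ {g} (mk∣ₚ h gh≈f) q = mk∣ₚ (mulP h q) (≈-trans (≐⇒≈ (≐-sym (mulP-assoc g h q))) (mulP-cong≈ˡ q gh≈f))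

  ∣ₚ-addP : ∀ {g f f′} → g ∣ₚ f → g ∣ₚ f′ → g ∣ₚ addP f f′
  ∣ₚ-addP {g} (mk∣ₚ h gh≈f) (mk∣ₚ h′ gh′≈f′) =
    mk∣ₚ (addP h h′) (≈-trans (≐⇒≈ (mulP-distribˡ g h h′)) (addP-cong≈ gh≈f gh′≈f′))

  record _∈⟨_,_⟩ (e f g : Poly) : Set where
    constructor combination
    field
      s t : Poly
      e≈fs+gt : e ≈ addP (mulP f s) (mulP g t)

  module _ {f g : Poly} where

    ∈-resp-≈ : ∀ {a b} → a ≈ b → a ∈⟨ f , g ⟩ → b ∈⟨ f , g ⟩
    ∈-resp-≈ a≈b (combination s t a≈fs+gt) = combination s t (≈-trans (≈-sym a≈b) a≈fs+gt)

    ∈-mulP : ∀ {a} → a ∈⟨ f , g ⟩ → ∀ q → mulP a q ∈⟨ f , g ⟩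
    ∈-mulP {a} (combination s t a≈fs+gt) q = combination (mulP s q) (mulP t q) (begin
      mulP a q                                   ≈⟨ mulP-cong≈ˡ q a≈fs+gt ⟩
      mulP (addP (mulP f s) (mulP g t)) q        ≈⟨ ≐⇒≈ (mulP-distribʳ (mulP f s) (mulP g t) q) ⟩
      addP (mulP (mulP f s) q) (mulP (mulP g t) q) ≈⟨ ≐⇒≈ (addP-cong (mulP-assoc f s q) (mulP-assoc g t q)) ⟩
      addP (mulP f (mulP s q)) (mulP g (mulP t q)) ∎)
      where open ≈-Reasoning

    ∈-addP : ∀ {a b} → a ∈⟨ f , g ⟩ → b ∈⟨ f , g ⟩ → addP a b ∈⟨ f , g ⟩
    ∈-addP {a} {b} (combination s t a≈) (combination s′ t′ b≈) = combination (addP s s′) (addP t t′) (begin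
      addP a b
        ≈⟨ addP-cong≈ a≈ b≈ ⟩
      addP (addP (mulP f s) (mulP g t)) (addP (mulP f s′) (mulP g t′))
        ≈⟨ ≐⇒≈ (addP-interchange (mulP f s) (mulP g t) (mulP f s′) (mulP g t′)) ⟩
      addP (addP (mulP f s) (mulP f s′)) (addP (mulP g t) (mulP g t′))
        ≈⟨ ≐⇒≈ (≐-sym (addP-cong (mulP-distribˡ f s s′) (mulP-distribˡ g t t′))) ⟩
      addP (mulP f (addP s s′)) (mulP g (addP t t′))
        ∎)
      where open ≈-Reasoning

    ∈-left : f ∈⟨ f , g ⟩
    ∈-left = combination oneP [] (≐⇒≈ (≐-sym (≐-trans (addP-cong (mulP-identityʳ f) (mulP-zeroʳ g)) (addP-identityʳ f))))

    ∈-right : g ∈⟨ f , g ⟩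
    ∈-right = combination [] oneP (≐⇒≈ (≐-sym (addP-cong (mulP-zeroʳ f) (mulP-identityʳ g))))

    remainder∈ : ∀ {a b q r} → a ≈ addP (mulP b q) r → a ∈⟨ f , g ⟩ → b ∈⟨ f , g ⟩ → r ∈⟨ f , g ⟩
    remainder∈ {a} {b} {q} {r} a≈bq+r a∈ b∈ = ∈-resp-≈ a-bq≈r (∈-addP a∈ (∈-mulP b∈ (scaleP -1ℤ q)))
      where
      a-bq≈r : addP a (mulP b (scaleP -1ℤ q)) ≈ r
      a-bq≈r = begin
        addP a (mulP b (scaleP -1ℤ q))      ≈⟨ ≐⇒≈ (addP-cong (≐-refl {x = a}) (mulP-scaleP -1ℤ b q)) ⟩
        subP a (mulP b q)                   ≈⟨ subP-cong≈ a≈bq+r ≈-refl ⟩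
        subP (addP (mulP b q) r) (mulP b q) ≈⟨ ≐⇒≈ (subP-addP-cancelˡ (mulP b q) r) ⟩
        r                                   ∎
        where open ≈-Reasoning

  toP-cong≈ : ∀ {r} {u v : Fin r → ℤ} → (∀ i → + p ∣ u i - v i) → toP u ≈ toP v
  toP-cong≈ {r} {u} {v} u≡v = mk≈ coeff
    where
    coeff : ∀ m → + p ∣ nth (toP u) m - nth (toP v) m
    coeff m with ℕ.<-≤-connex m r
    ... | inj₁ m<r = subst (+ p ∣_) (sym (cong₂ _-_ (nth-toP< u m<r) (nth-toP< v m<r))) (u≡v _)
    ... | inj₂ r≤m = subst (+ p ∣_) (sym (cong₂ _-_ (nth-toP≥ u m r≤m) (nth-toP≥ v m r≤m))) p∣0

  DegreeBelow-toP : ∀ {r} (u : Fin r → ℤ) → DegreeBelow r (toP u)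
  DegreeBelow-toP u m r≤m = subst (+ p ∣_) (sym (nth-toP≥ u m r≤m)) p∣0

  toP-nth : ∀ {r} f → DegreeBelow r f → toP {r} (λ i → nth f (toℕ i)) ≈ f
  toP-nth {r} f f<r = mk≈ coeff
    where
    coeff : ∀ m → + p ∣ nth (toP {r} (λ i → nth f (toℕ i))) m - nth f m
    coeff m with ℕ.<-≤-connex m r
    ... | inj₁ m<r = subst (λ x → + p ∣ x - nth f m)
                       (sym (trans (nth-toP< _ m<r) (cong (nth f) (Fin.toℕ-fromℕ< m<r)))) (p∣-cancel (nth f m))
    ... | inj₂ r≤m = subst (λ x → + p ∣ x - nth f m) (sym (nth-toP≥ _ m r≤m))
                       (subst (+ p ∣_) (sym (ℤ.+-identityˡ (- nth f m))) (∣m⇒∣-m (f<r m r≤m)))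

  record _≡_⟨mod_⟩ (a b m : Poly) : Set where
    constructor ≡mod
    field
      quotient : Poly
      a-b≈mq   : subP a b ≈ mulP m quotient

  module _ {m : Poly} where

    ≈⇒≡mod : ∀ {a b} → a ≈ b → a ≡ b ⟨mod m ⟩
    ≈⇒≡mod a≈b = ≡mod [] (≈-trans (IsZero⇒≈[] (≈⇒IsZero-subP a≈b)) (≐⇒≈ (≐-sym (mulP-zeroʳ m))))

    ≡mod-trans : ∀ {a b c} → a ≡ b ⟨mod m ⟩ → b ≡ c ⟨mod m ⟩ → a ≡ c ⟨mod m ⟩
    ≡mod-trans {a} {b} {c} (≡mod q a-b≈mq) (≡mod q′ b-c≈mq′) = ≡mod (addP q q′) (begin
      subP a c                           ≈⟨ ≐⇒≈ (subP-split a b c) ⟩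
      addP (subP a b) (subP b c)         ≈⟨ addP-cong≈ a-b≈mq b-c≈mq′ ⟩
      addP (mulP m q) (mulP m q′)        ≈⟨ ≐⇒≈ (≐-sym (mulP-distribˡ m q q′)) ⟩
      mulP m (addP q q′)                 ∎)
      where open ≈-Reasoning

    ≡mod-mulPˡ : ∀ c {a b} → a ≡ b ⟨mod m ⟩ → mulP c a ≡ mulP c b ⟨mod m ⟩
    ≡mod-mulPˡ c {a} {b} (≡mod q a-b≈mq) = ≡mod (mulP c q) (begin
      subP (mulP c a) (mulP c b)    ≈⟨ ≐⇒≈ (≐-sym (mulP-subP c a b)) ⟩
      mulP c (subP a b)             ≈⟨ mulP-cong≈ʳ c a-b≈mq ⟩
      mulP c (mulP m q)             ≈⟨ ≐⇒≈ (mulP-leftComm c m q) ⟩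
      mulP m (mulP c q)             ∎)
      where open ≈-Reasoning

    ≈-respˡ-≡mod : ∀ {a a′ b} → a ≈ a′ → a ≡ b ⟨mod m ⟩ → a′ ≡ b ⟨mod m ⟩
    ≈-respˡ-≡mod a≈a′ a≡b = ≡mod-trans (≈⇒≡mod (≈-sym a≈a′)) a≡b

  ≡mod-remainder : ∀ {a m q r} → a ≈ addP (mulP m q) r → a ≡ r ⟨mod m ⟩
  ≡mod-remainder {a} {m} {q} {r} a≈mq+r = ≡mod q (≈-trans (subP-cong≈ a≈mq+r ≈-refl) (≐⇒≈ (subP-addP-cancelʳ (mulP m q) r)))

  ∈⟨⟩⇒≡mod : ∀ {e f g} (e∈ : e ∈⟨ f , g ⟩) → e ≡ mulP f (_∈⟨_,_⟩.s e∈) ⟨mod g ⟩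
  ∈⟨⟩⇒≡mod {e} {f} {g} (combination s t e≈fs+gt) = ≡mod t (begin
    subP e (mulP f s)                                 ≈⟨ subP-cong≈ e≈fs+gt ≈-refl ⟩
    subP (addP (mulP f s) (mulP g t)) (mulP f s)      ≈⟨ ≐⇒≈ (subP-addP-cancelˡ (mulP f s) (mulP g t)) ⟩
    mulP g t                                          ∎)
    where open ≈-Reasoning

-- Polynomials over 𝔽_p

module PrimeField {p : ℕ} (p-prime : Prime p) where

  open Congruence p public

  p∤1 : ¬ + p ∣ 1ℤ
  p∤1 p∣1 = ℕ.nonTrivial⇒≢1 {{prime⇒nonTrivial p-prime}} (ℕ.∣1⇒≡1 (∣⇒∣ᵤ p∣1))

  p∤* : ∀ {a b} → ¬ + p ∣ a → ¬ + p ∣ b → ¬ + p ∣ a * b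
  p∤* {a} {b} p∤a p∤b p∣ab with euclidsLemma ℤ.∣ a ∣ ℤ.∣ b ∣ p-prime (subst (p ℕ.∣_) (ℤ.abs-* a b) (∣⇒∣ᵤ p∣ab))
  ... | inj₁ p∣a = p∤a (∣ᵤ⇒∣ p∣a)
  ... | inj₂ p∣b = p∤b (∣ᵤ⇒∣ p∣b)

  coprimeTo-p : ∀ {n} → ¬ p ℕ.∣ n → Coprime n p
  coprimeTo-p p∤n (d∣n , d∣p) with prime⇒irreducible p-prime d∣p
  ... | inj₁ d≡1  = d≡1
  ... | inj₂ refl = contradiction d∣n p∤n

  pos-+*≡* : ∀ a b c d e → a ℕ.+ b ℕ.* c ≡ d ℕ.* e → + a + + b * + c ≡ + d * + e
  pos-+*≡* a b c d e eq = begin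
    + a + + b * + c       ≡⟨ cong (λ x → + a + x) (ℤ.pos-* b c) ⟨
    + a + + (b ℕ.* c)     ≡⟨ ℤ.pos-+ a (b ℕ.* c) ⟨
    + (a ℕ.+ b ℕ.* c)     ≡⟨ cong +_ eq ⟩
    + (d ℕ.* e)           ≡⟨ ℤ.pos-* d e ⟩
    + d * + e             ∎
    where open ≡-Reasoning

  inverseℕ : ∀ n → ¬ p ℕ.∣ n → Σ ℤ λ b → + p ∣ + n * b - 1ℤ
  inverseℕ n p∤n with coprime-Bézout (coprimeTo-p p∤n)
  ... | Bézout.+- x y 1+yp≡xn = + x , divides (+ y) (begin
    + n * + x - 1ℤ          ≡⟨ cong (_- 1ℤ) (ℤ.*-comm (+ n) (+ x)) ⟩
    + x * + n - 1ℤ          ≡⟨ cong (_- 1ℤ) (pos-+*≡* 1 y p x n 1+yp≡xn) ⟨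
    (1ℤ + + y * + p) - 1ℤ   ≡⟨ cancel (+ y * + p) ⟩
    + y * + p               ∎)
    where
    open ≡-Reasoning
    cancel : ∀ a → (1ℤ + a) - 1ℤ ≡ a
    cancel = solve-∀
  ... | Bézout.-+ x y 1+xn≡yp = - + x , divides (- + y) (begin
    + n * - + x - 1ℤ        ≡⟨ regroup (+ n) (+ x) ⟩
    - (1ℤ + + x * + n)      ≡⟨ cong -_ (pos-+*≡* 1 x n y p 1+xn≡yp) ⟩
    - (+ y * + p)           ≡⟨ ℤ.neg-distribˡ-* (+ y) (+ p) ⟩
    - + y * + p             ∎)
    where
    open ≡-Reasoning
    regroup : ∀ a b → a * - b - 1ℤ ≡ - (1ℤ + b * a)
    regroup = solve-∀

  inverse : ∀ a → ¬ + p ∣ a → Σ ℤ λ b → + p ∣ a * b - 1ℤ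
  inverse a p∤a with inverseℕ ℤ.∣ a ∣ (λ p∣∣a∣ → p∤a (∣ᵤ⇒∣ p∣∣a∣)) | ℤ.+∣i∣≡i⊎+∣i∣≡-i a
  ... | b , p∣∣a∣b-1 | inj₁ ∣a∣≡a  = b , subst (λ x → + p ∣ x * b - 1ℤ) ∣a∣≡a p∣∣a∣b-1
  ... | b , p∣∣a∣b-1 | inj₂ ∣a∣≡-a =
    - b , subst (λ x → + p ∣ x - 1ℤ) (trans (cong (_* b) ∣a∣≡-a) (negSwap a b)) p∣∣a∣b-1
    where
    negSwap : ∀ a b → - a * b ≡ a * - b
    negSwap = solve-∀

  record HasDegree (m : ℕ) (f : Poly) : Set where
    constructor hasDegree
    field
      leading : ¬ + p ∣ nth f m
      below   : DegreeBelow (suc m) f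
  open HasDegree public

  HasDegree-≈ : ∀ {m f g} → f ≈ g → HasDegree m f → HasDegree m g
  HasDegree-≈ {m} f≈g (hasDegree lead f<m) =
    hasDegree (λ p∣g → lead (p∣-transfer (atz (≈-sym f≈g) m) p∣g)) (DegreeBelow-≈ f≈g f<m)

  HasDegree⇒< : ∀ {m n f} → HasDegree m f → DegreeBelow n f → m < n
  HasDegree⇒< {m} {n} f° f<n with ℕ.<-cmp m n
  ... | tri< m<n _ _ = m<n
  ... | tri≈ _ refl _ = contradiction (f<n m ℕ.≤-refl) (leading f°)
  ... | tri> _ _ n<m = contradiction (f<n m (ℕ.<⇒≤ n<m)) (leading f°)

  HasDegree-unique : ∀ {m n f} → HasDegree m f → HasDegree n f → m ≡ n
  HasDegree-unique f°m f°n =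
    ℕ.≤-antisym (ℕ.≤-pred (HasDegree⇒< f°m (below f°n))) (ℕ.≤-pred (HasDegree⇒< f°n (below f°m)))

  ¬IsZero : ∀ {m f} → HasDegree m f → ¬ IsZero f
  ¬IsZero f° f≈0 = leading f° (f≈0 _)

  isZeroP-sound : ∀ f → isZeroP p f ≡ true → IsZero f
  isZeroP-sound []      _ i = p∣0
  isZeroP-sound (a ∷ f) eq i with p ℕ.∣? ℤ.∣ a ∣ | i
  isZeroP-sound (a ∷ f) eq i | yes p∣a | zero  = ∣ᵤ⇒∣ p∣a
  isZeroP-sound (a ∷ f) eq i | yes _   | suc j = isZeroP-sound f eq j
  isZeroP-sound (a ∷ f) () i | no _    | _

  isZeroP-complete : ∀ f → IsZero f → isZeroP p f ≡ true
  isZeroP-complete []      _   = refl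
  isZeroP-complete (a ∷ f) f≈0 with p ℕ.∣? ℤ.∣ a ∣
  ... | yes _   = isZeroP-complete f (λ i → f≈0 (suc i))
  ... | no p∤a = contradiction (∣⇒∣ᵤ (f≈0 0)) p∤a

  IsZero⊎HasDegree : ∀ f → IsZero f ⊎ HasDegree (deg p f) f
  IsZero⊎HasDegree [] = inj₁ λ _ → p∣0
  IsZero⊎HasDegree (a ∷ f) with isZeroP p f in eq
  ... | true with + p ∣? a
  ...   | yes p∣a = inj₁ λ { zero → p∣a ; (suc i) → isZeroP-sound f eq i }
  ...   | no  p∤a = inj₂ (hasDegree p∤a λ { (suc i) _ → isZeroP-sound f eq i })
  IsZero⊎HasDegree (a ∷ f) | false with IsZero⊎HasDegree f
  ...   | inj₁ f≈0 = contradiction (trans (sym eq) (isZeroP-complete f f≈0)) λ ()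
  ...   | inj₂ f° = inj₂ (hasDegree (leading f°) λ { (suc i) (s≤s m≤i) → below f° i m≤i })

  IsZero⇒deg≡0 : ∀ f → IsZero f → deg p f ≡ 0
  IsZero⇒deg≡0 []      _   = refl
  IsZero⇒deg≡0 (a ∷ f) f≈0 rewrite isZeroP-complete f (λ i → f≈0 (suc i)) = refl

  nonconstant⇒HasDegree : ∀ f → 1 ≤ deg p f → HasDegree (deg p f) f
  nonconstant⇒HasDegree f 1≤deg with IsZero⊎HasDegree f
  ... | inj₁ f≈0 = contradiction (IsZero⇒deg≡0 f f≈0) (ℕ.>⇒≢ 1≤deg)
  ... | inj₂ f° = f°

  HasDegree-mulP : ∀ {m n f g} → HasDegree m f → HasDegree n g → HasDegree (m ℕ.+ n) (mulP f g)
  HasDegree-mulP {f = []} f° _ = contradiction p∣0 (leading f°)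
  HasDegree-mulP {zero} {n} {a ∷ f} {g} (hasDegree p∤a a∷f<1) g° = hasDegree
    (λ p∣ → p∤* p∤a (leading g°) (∣m+n∣n⇒∣m (subst (+ p ∣_) (nth-mulP-∷ a f g n) p∣) (p∣x·fg n)))
    (λ i n<i → subst (+ p ∣_) (sym (nth-mulP-∷ a f g i)) (∣m∣n⇒∣m+n (∣n⇒∣m*n a (below g° i n<i)) (p∣x·fg i)))
    where
    p∣x·fg : ∀ i → + p ∣ nth (0ℤ ∷ mulP f g) i
    p∣x·fg zero    = p∣0
    p∣x·fg (suc i) = IsZero-mulPˡ f g (λ j → a∷f<1 (suc j) (s≤s z≤n)) i
  HasDegree-mulP {suc m} {n} {a ∷ f} {g} (hasDegree lead a∷f<) g° = hasDegree
    (λ p∣ → leading fg° (∣m+n∣m⇒∣n (subst (+ p ∣_) (nth-mulP-∷ a f g (suc (m ℕ.+ n))) p∣) (p∣a·g (s≤s (ℕ.m≤n+m n m)))))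
    (λ { (suc i) (s≤s m+n<i) → subst (+ p ∣_) (sym (nth-mulP-∷ a f g (suc i)))
           (∣m∣n⇒∣m+n (p∣a·g (s≤s (ℕ.≤-trans (ℕ.m≤n+m n m) (ℕ.<⇒≤ m+n<i)))) (below fg° i m+n<i)) })
    where
    fg° : HasDegree (m ℕ.+ n) (mulP f g)
    fg° = HasDegree-mulP {f = f} (hasDegree lead λ i m<i → a∷f< (suc i) (s≤s m<i)) g°
    p∣a·g : ∀ {i} → n < i → + p ∣ a * nth g i
    p∣a·g {i} n<i = ∣n⇒∣m*n a (below g° i n<i)

  IsZero-mulP-cancelˡ : ∀ {D d w} → HasDegree D d → IsZero (mulP d w) → IsZero w
  IsZero-mulP-cancelˡ {w = w} d° dw≈0 with IsZero⊎HasDegree w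
  ... | inj₁ w≈0 = w≈0
  ... | inj₂ w° = contradiction dw≈0 (¬IsZero (HasDegree-mulP d° w°))

  DegreeBelow-mulP : ∀ {D r d w} → HasDegree D d → DegreeBelow r w → DegreeBelow (D ℕ.+ r) (mulP d w)
  DegreeBelow-mulP {D} {r} {d} {w} d° w<r with IsZero⊎HasDegree w
  ... | inj₁ w≈0 = λ i _ → IsZero-mulPʳ d w w≈0 i
  ... | inj₂ w° = DegreeBelow-mono {f = mulP d w}
    (subst (ℕ._≤ D ℕ.+ r) (ℕ.+-suc D (deg p w)) (ℕ.+-monoʳ-≤ D (HasDegree⇒< w° w<r)))
    (below (HasDegree-mulP d° w°))

  DegreeBelow-quotient : ∀ {D K d w} → HasDegree D d → DegreeBelow K (mulP d w) → DegreeBelow (K ∸ D) w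
  DegreeBelow-quotient {D} {K} {d} {w} d° dw<K with IsZero⊎HasDegree w
  ... | inj₁ w≈0 = λ i _ → w≈0 i
  ... | inj₂ w° = DegreeBelow-mono {f = w}
    (ℕ.m+n≤o⇒m≤o∸n (suc (deg p w)) (subst (ℕ._≤ K) (cong suc (ℕ.+-comm D (deg p w))) D+deg<K))
    (below w°)
    where
    D+deg<K : D ℕ.+ deg p w < K
    D+deg<K = HasDegree⇒< (HasDegree-mulP d° w°) dw<K

  cancelLeading : ∀ {m b R} → HasDegree m b → DegreeBelow (suc m) R → Σ ℤ λ s → DegreeBelow m (subP R (scaleP s b))
  cancelLeading {m} {b} {R} b° R<m+1 = nth R m * β , R-sb<m
    where
    β = proj₁ (inverse (nth b m) (leading b°))
    p∣bβ-1 : + p ∣ nth b m * β - 1ℤ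
    p∣bβ-1 = proj₂ (inverse (nth b m) (leading b°))
    nth-R-sb : ∀ i → nth (subP R (scaleP (nth R m * β) b)) i ≡ nth R i - nth R m * β * nth b i
    nth-R-sb i = trans (nth-subP R (scaleP (nth R m * β) b) i) (cong (_-_ (nth R i)) (nth-scaleP (nth R m * β) b i))
    R-sb<m : DegreeBelow m (subP R (scaleP (nth R m * β) b))
    R-sb<m i m≤i with ℕ.m≤n⇒m<n∨m≡n m≤i
    ... | inj₂ refl = subst (+ p ∣_) (trans (leading-cancels (nth R m) β (nth b m)) (sym (nth-R-sb m)))
                        (∣m⇒∣-m (∣n⇒∣m*n (nth R m) p∣bβ-1))
      where
      leading-cancels : ∀ c β b → - (c * (b * β - 1ℤ)) ≡ c - c * β * b
      leading-cancels = solve-∀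
    ... | inj₁ m<i = subst (+ p ∣_) (sym (nth-R-sb i))
                       (∣m∣n⇒∣m-n (R<m+1 i m<i) (∣n⇒∣m*n (nth R m * β) (below b° i m<i)))

  division-∷ : ∀ {a a′ b q′ r′} s → a′ ≈ addP (mulP b q′) r′ →
               a ∷ a′ ≈ addP (mulP b (s ∷ q′)) (subP (a ∷ r′) (scaleP s b))
  division-∷ {a} {a′} {b} {q′} {r′} s a′≈bq′+r′ = begin
    a ∷ a′                                          ≈⟨ ∷-cong≈ a a′≈bq′+r′ ⟩
    a ∷ addP (mulP b q′) r′                         ≈⟨ ≐⇒≈ (∷-cong (sym (ℤ.+-identityˡ a)) ≐-refl) ⟩
    addP (0ℤ ∷ mulP b q′) R                         ≈⟨ ≐⇒≈ (addP-cong (≐-refl {x = 0ℤ ∷ mulP b q′})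
                                                                     (≐-sym (addP-subP-cancel R (scaleP s b)))) ⟩
    addP (0ℤ ∷ mulP b q′) (addP (scaleP s b) r)     ≈⟨ ≐⇒≈ (addP-leftComm (0ℤ ∷ mulP b q′) (scaleP s b) r) ⟩
    addP (scaleP s b) (addP (0ℤ ∷ mulP b q′) r)     ≈⟨ ≐⇒≈ (≐-sym (addP-assoc (scaleP s b) (0ℤ ∷ mulP b q′) r)) ⟩
    addP (addP (scaleP s b) (0ℤ ∷ mulP b q′)) r     ≈⟨ ≐⇒≈ (addP-cong (≐-sym (mulP-∷ʳ b s q′)) ≐-refl) ⟩
    addP (mulP b (s ∷ q′)) r                        ∎
    where
    open ≈-Reasoning
    R = a ∷ r′
    r = subP R (scaleP s b)

  record Division (a b : Poly) (m : ℕ) : Set where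
    constructor division
    field
      quot rem : Poly
      a≈bq+r   : a ≈ addP (mulP b quot) rem
      rem<m    : DegreeBelow m rem

  divMod : ∀ {m b} → HasDegree m b → ∀ a → Division a b m
  divMod {m} {b} b° [] = division [] [] (≐⇒≈ (≐-sym (≐-trans (addP-identityʳ (mulP b [])) (mulP-zeroʳ b)))) λ _ _ → p∣0
  divMod {m} {b} b° (a ∷ a′) =
    let division q′ r′ a′≈bq′+r′ r′<m = divMod b° a′
        s , r<m = cancelLeading {R = a ∷ r′} b° λ { (suc i) (s≤s m≤i) → r′<m i m≤i }
    in division (s ∷ q′) (subP (a ∷ r′) (scaleP s b)) (division-∷ {b = b} s a′≈bq′+r′) r<m

  euclid : ∀ {f g} n a b → DegreeBelow n b → a ∈⟨ f , g ⟩ → b ∈⟨ f , g ⟩ →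
           Σ Poly λ e → e ∣ₚ a × e ∣ₚ b × e ∈⟨ f , g ⟩
  euclid n a b b<n a∈ b∈ with IsZero⊎HasDegree b
  ... | inj₁ b≈0 = a , ∣ₚ-refl a , ∣ₚ-zero a b≈0 , a∈
  euclid zero    a b b<0 a∈ b∈ | inj₂ b° = contradiction (λ i → b<0 i z≤n) (¬IsZero b°)
  euclid (suc n) a b b<n a∈ b∈ | inj₂ b° with divMod b° a
  ... | division q r a≈bq+r r<deg =
    let e , e∣b , e∣r , e∈ = euclid n b r r<n b∈ (remainder∈ a≈bq+r a∈ b∈)
    in e , ∣ₚ-resp-≈ (∣ₚ-addP (∣ₚ-mulPʳ e∣b q) e∣r) (≈-sym a≈bq+r) , e∣b , e∈
    where
    r<n : DegreeBelow n r
    r<n = DegreeBelow-mono {f = r} (ℕ.≤-pred (HasDegree⇒< b° b<n)) r<deg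

  commonDivisor∈⟨⟩ : ∀ f g → Σ Poly λ e → e ∣ₚ f × e ∣ₚ g × e ∈⟨ f , g ⟩
  commonDivisor∈⟨⟩ f g = euclid (length g) f g g<length ∈-left ∈-right
    where
    g<length : DegreeBelow (length g) g
    g<length i length≤i = subst (+ p ∣_) (sym (nth-≥length g i length≤i)) p∣0

  IsGCDP⇒∈⟨⟩ : ∀ {f g d} → IsGCDP p f g d → d ∈⟨ f , g ⟩
  IsGCDP⇒∈⟨⟩ {f} {g} (_ , _ , greatest) with commonDivisor∈⟨⟩ f g
  ... | e , e∣f , e∣g , e∈ with greatest e (∣ₚ⇒∣P e∣f) (∣ₚ⇒∣P e∣g)
  ...   | q , eq≈d = ∈-resp-≈ (≈P⇒≈ eq≈d) (∈-mulP e∈ q)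

  HasDegree-oneP : HasDegree 0 oneP
  HasDegree-oneP = hasDegree p∤1 λ { (suc i) _ → p∣0 }

  HasDegree-xᵏ-1 : ∀ k → 1 ≤ k → HasDegree k (xᵏ-1 k)
  HasDegree-xᵏ-1 (suc k) _ = hasDegree
    (λ p∣ → p∤1 (subst (+ p ∣_) (xᵏ-at k) p∣))
    (λ { (suc i) (s≤s k<i) → subst (+ p ∣_) (sym (xᵏ-beyond k i k<i)) p∣0 })
    where
    xᵏ-at : ∀ k → nth (shiftP k oneP) k ≡ 1ℤ
    xᵏ-at zero    = refl
    xᵏ-at (suc k) = xᵏ-at k
    xᵏ-beyond : ∀ k i → k < i → nth (shiftP k oneP) i ≡ 0ℤ
    xᵏ-beyond zero    (suc i) _         = refl
    xᵏ-beyond (suc k) (suc i) (s≤s k<i) = xᵏ-beyond k i k<i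

  HasDegree-prodP : ∀ {hs} → All (λ h → HasDegree (deg p h) h) hs → HasDegree (sum (map (deg p) hs)) (prodP hs)
  HasDegree-prodP All.[]         = HasDegree-oneP
  HasDegree-prodP (h° All.∷ hs°) = HasDegree-mulP h° (HasDegree-prodP hs°)

  mulP-cancelˡ : ∀ {D d f g} → HasDegree D d → mulP d f ≈ mulP d g → f ≈ g
  mulP-cancelˡ {d = d} {f} {g} d° df≈dg = IsZero-subP⇒≈ (IsZero-mulP-cancelˡ d° λ i →
    subst (+ p ∣_) (sym (at (mulP-subP d f g) i)) (≈⇒IsZero-subP df≈dg i))

  ∣ₚ⇒≤ : ∀ {D K d f} → HasDegree D d → HasDegree K f → d ∣ₚ f → D ≤ K
  ∣ₚ⇒≤ {D} {K} {d} {f} d° f° (mk∣ₚ h dh≈f) with IsZero⊎HasDegree h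
  ... | inj₁ h≈0 = contradiction (λ i → p∣-transfer (atz dh≈f i) (IsZero-mulPʳ d h h≈0 i)) (¬IsZero f°)
  ... | inj₂ h° = subst (D ≤_) (HasDegree-unique (HasDegree-≈ dh≈f (HasDegree-mulP d° h°)) f°) (ℕ.m≤m+n D _)

  ≡mod-reduced : ∀ {n m a b} → HasDegree n m → a ≡ b ⟨mod m ⟩ → DegreeBelow n a → DegreeBelow n b → a ≈ b
  ≡mod-reduced {n} {m} {a} {b} m° (≡mod q a-b≈mq) a<n b<n =
    IsZero-subP⇒≈ (≈[]⇒IsZero (≈-trans a-b≈mq (IsZero⇒≈[] (IsZero-mulPʳ m q q≈0))))
    where
    q<0 : DegreeBelow (n ∸ n) q
    q<0 = DegreeBelow-quotient m° (DegreeBelow-≈ a-b≈mq (DegreeBelow-subP {f = a} a<n b<n))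
    q≈0 : IsZero q
    q≈0 i = q<0 i (subst (_≤ i) (sym (ℕ.n∸n≡0 n)) z≤n)

-- The monodromy group

module Monodromy {p : ℕ} (p-prime : Prime p) {k : ℕ} (1≤k : 1 ≤ k) (as : Vec ℕ k)
                 {D : ℕ} {d : Poly} (d° : PrimeField.HasDegree p-prime D d)
                 (d∣F : Congruence._∣ₚ_ p d (polyOf as)) (d∣X : Congruence._∣ₚ_ p d (xᵏ-1 k))
                 (d∈ : Congruence._∈⟨_,_⟩ p d (polyOf as) (xᵏ-1 k)) where
  open PrimeField p-prime
  open Circulant as

  X : Poly
  X = xᵏ-1 k

  r : ℕ
  r = k ∸ D

  D+r≡k : D ℕ.+ r ≡ k
  D+r≡k = ℕ.m+[n∸m]≡n (∣ₚ⇒≤ d° (HasDegree-xᵏ-1 k 1≤k) d∣X)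

  DegreeBelow-d· : ∀ {u} → DegreeBelow r u → DegreeBelow k (mulP d u)
  DegreeBelow-d· {u} u<r = subst (λ n → DegreeBelow n (mulP d u)) D+r≡k (DegreeBelow-mulP d° u<r)

  φ : (Fin r → ℤ) → Fin k → ℤ
  φ u i = nth (mulP d (toP u)) (toℕ i)

  ≈⇒≈[p] : ∀ {n} {u v : Fin n → ℤ} → toP u ≈ toP v → u ≈[ p ] v
  ≈⇒≈[p] {u = u} {v} u≈v i = ∣⇒∣ᵤ (subst (+ p ∣_) (cong₂ _-_ (nth-toP u i) (nth-toP v i)) (atz u≈v (toℕ i)))

  ≈[p]⇒≈ : ∀ {n} {u v : Fin n → ℤ} → u ≈[ p ] v → toP u ≈ toP v
  ≈[p]⇒≈ u≈v = toP-cong≈ λ i → ∣ᵤ⇒∣ (u≈v i)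

  φ-cong : ∀ u u′ → u ≈[ p ] u′ → φ u ≈[ p ] φ u′
  φ-cong u u′ u≈u′ i = ∣⇒∣ᵤ (atz (mulP-cong≈ʳ d (≈[p]⇒≈ u≈u′)) (toℕ i))

  φ-hom : ∀ u u′ → φ (λ i → u i + u′ i) ≈[ p ] (λ i → φ u i + φ u′ i)
  φ-hom u u′ i = ∣⇒∣ᵤ (subst (λ x → + p ∣ φ (λ i → u i + u′ i) i - x)
    (nth-addP (mulP d (toP u)) (mulP d (toP u′)) (toℕ i))
    (atz (≐⇒≈ (≐-trans (mulP-congʳ d (toP-addP u u′)) (mulP-distribˡ d (toP u) (toP u′)))) (toℕ i)))

  φ-injective : ∀ u u′ → φ u ≈[ p ] φ u′ → u ≈[ p ] u′
  φ-injective u u′ φu≈φu′ = ≈⇒≈[p] (mulP-cancelˡ d° (begin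
    mulP d (toP u)        ≈⟨ toP-nth (mulP d (toP u)) (DegreeBelow-d· (DegreeBelow-toP u)) ⟨
    toP (φ u)             ≈⟨ ≈[p]⇒≈ φu≈φu′ ⟩
    toP (φ u′)            ≈⟨ toP-nth (mulP d (toP u′)) (DegreeBelow-d· (DegreeBelow-toP u′)) ⟩
    mulP d (toP u′)       ∎))
    where open ≈-Reasoning

  circulant-≡mod : ∀ c → mulP F (toP c) ≡ toP (λ i → Σℤ (λ j → c j * circ as i j)) ⟨mod X ⟩
  circulant-≡mod c = ≡mod (linComb c overflow) (≐⇒≈ (begin
    subP (mulP F (toP c)) (toP (λ i → Σℤ (λ j → c j * circ as i j)))
      ≈⟨ subP-cong (≐-refl {x = mulP F (toP c)}) (≐-trans (circulant 1≤k c) (subP-cong (mulP-comm (toP c) F) ≐-refl)) ⟩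
    subP (mulP F (toP c)) (subP (mulP F (toP c)) (mulP X (linComb c overflow)))
      ≈⟨ subP-subP-cancel (mulP F (toP c)) (mulP X (linComb c overflow)) ⟩
    mulP X (linComb c overflow) ∎))
    where open ≐-Reasoning

  φ-image : ∀ u → InN p as (φ u)
  φ-image u = c , λ i → ≈⇒≈[p] {u = φ u} {v = λ i → Σℤ (λ j → c j * circ as i j)} (begin
      toP (φ u)                    ≈⟨ toP-nth (mulP d U) (DegreeBelow-d· (DegreeBelow-toP u)) ⟩
      mulP d U                     ≈⟨ ≡mod-reduced (HasDegree-xᵏ-1 k 1≤k) dU≡circ
                                                    (DegreeBelow-d· (DegreeBelow-toP u)) (DegreeBelow-toP _) ⟩
      toP (λ i → Σℤ (λ j → c j * circ as i j)) ∎) i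
    where
    open ≈-Reasoning
    U = toP u
    dU∈ : mulP d U ∈⟨ F , X ⟩
    dU∈ = ∈-mulP d∈ U
    w = _∈⟨_,_⟩.s dU∈
    open Division (divMod (HasDegree-xᵏ-1 k 1≤k) w) renaming (rem to W; a≈bq+r to w≈Xq+W; rem<m to W<k)
    c : Fin k → ℤ
    c j = nth W (toℕ j)
    dU≡circ : mulP d U ≡ toP (λ i → Σℤ (λ j → c j * circ as i j)) ⟨mod X ⟩
    dU≡circ = ≡mod-trans (∈⟨⟩⇒≡mod dU∈) (≡mod-trans (≡mod-mulPˡ F (≡mod-remainder w≈Xq+W))
      (≈-respˡ-≡mod (mulP-cong≈ʳ F (toP-nth W W<k)) (circulant-≡mod c)))

  φ-surjective : ∀ v → InN p as v → Σ (Fin r → ℤ) λ u → φ u ≈[ p ] v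
  φ-surjective v (c , v≡Mc) = u , ≈⇒≈[p] (begin
      toP (φ u)         ≈⟨ toP-nth (mulP d (toP u)) (DegreeBelow-d· (DegreeBelow-toP u)) ⟩
      mulP d (toP u)    ≈⟨ mulP-cong≈ʳ d (toP-nth w w<r) ⟩
      mulP d w          ≈⟨ v≈dw ⟨
      toP v             ∎)
    where
    open ≈-Reasoning
    open _∣ₚ_ d∣F renaming (cofactor to g; g·h≈f to dg≈F)
    open _∣ₚ_ d∣X renaming (cofactor to h; g·h≈f to dh≈X)
    C = toP c
    L = linComb c overflow
    w = subP (mulP g C) (mulP h L)
    v≈dw : toP v ≈ mulP d w
    v≈dw = begin
      toP v
        ≈⟨ ≈[p]⇒≈ v≡Mc ⟩
      toP (λ i → Σℤ (λ j → c j * circ as i j))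
        ≈⟨ ≐⇒≈ (circulant 1≤k c) ⟩
      subP (mulP C F) (mulP X L)
        ≈⟨ subP-cong≈ (mulP-cong≈ʳ C (≈-sym dg≈F)) (mulP-cong≈ˡ L (≈-sym dh≈X)) ⟩
      subP (mulP C (mulP d g)) (mulP (mulP d h) L)
        ≈⟨ ≐⇒≈ (subP-cong (≐-trans (mulP-leftComm C d g) (mulP-congʳ d (mulP-comm C g))) (mulP-assoc d h L)) ⟩
      subP (mulP d (mulP g C)) (mulP d (mulP h L))
        ≈⟨ ≐⇒≈ (mulP-subP d (mulP g C) (mulP h L)) ⟨
      mulP d w
        ∎
    w<r : DegreeBelow r w
    w<r = DegreeBelow-quotient d° (DegreeBelow-≈ v≈dw (DegreeBelow-toP v))
    u : Fin r → ℤ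
    u i = nth w (toℕ i)

  isomorphism : NIsoCpPow p as r
  isomorphism = φ , φ-cong , φ-hom , φ-injective , φ-image , φ-surjective

proposition7 : (p k : ℕ) → Prime p → 2 ≤ k → (as : Vec ℕ k) → IsAlgebraicGon k p as
    → (gs : List Poly) → All (IrreducibleP p) gs → prodP gs ≈P[ p ] xᵏ-1 k
    → (is : List (Fin (length gs))) → Unique is
    → IsGCDP p (polyOf as) (xᵏ-1 k) (prodP (map (lookup gs) is))
    → NIsoCpPow p as (k ∸ sum (map (λ i → deg p (lookup gs i)) is))
-- The k-gon condition, the factorization of x^k − 1 and the distinctness of the indices are not
-- needed: only the degree of the gcd matters.
proposition7 p k p-prime 2≤k as _ gs irreducible _ is _ gcd@(d∣F , d∣X , _) =
  Monodromy.isomorphism p-prime (ℕ.≤-trans (s≤s z≤n) 2≤k) as d° (∣P⇒∣ₚ d∣F) (∣P⇒∣ₚ d∣X) (IsGCDP⇒∈⟨⟩ gcd)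
  where
  open PrimeField p-prime
  factors° : All (λ g → HasDegree (deg p g) g) (map (lookup gs) is)
  factors° = map⁺ (All.tabulate λ {i} _ → nonconstant⇒HasDegree _ (proj₁ (All.lookup irreducible (∈-lookup i))))
  d° : HasDegree (sum (map (λ i → deg p (lookup gs i)) is)) (prodP (map (lookup gs) is))
  d° = subst (λ n → HasDegree n _) (cong sum (sym (List.map-∘ is))) (HasDegree-prodP factors°)
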